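{- Let $G$ be a graph, let $F$ be a feedback edge set of $G$, let $uv \in F$, and let $D$ be the set of endpoints of edges of $F$. Then there is at most one vertex $w \in V(G) \setminus D$ that is satisfied by $uv$.
   Context: All graphs are finite, simple and undirected. A feedback edge set of $G$ is $F \subseteq E(G)$ such that $G - F$ is a forest. For $uv \in F$ with $u,v$ in the same connected component of the forest $G-F$, let $P_{u,v}$ denote the unique path between $u$ and $v$ in $G - F$ (if $u,v$ are in different components, no vertex is satisfied by $uv$). A vertex $w$ is satisfied by the feedback edge $uv \in F$ if $w$ lies on $P_{u,v}$ and $u, v \in N_G(w)$. -}

module Defs where

open import Data.Nat using (ℕ; _≥_)
open import Data.Fin using (Fin)
open import Data.List using (List; []; _∷_; length)
open import Data.List.Membership.Propositional using (_∈_)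
open import Data.List.Relation.Unary.Unique.Propositional using (Unique)
open import Data.Product using (Σ; ∃; _×_)
open import Relation.Nullary using (¬_)
open import Relation.Binary.PropositionalEquality using (_≡_)
open import Level using (0ℓ; suc)

record Graph (n : ℕ) : Set₁ where
  field
    Adj   : Fin n → Fin n → Set
    sym   : ∀ {x y} → Adj x y → Adj y x
    irrefl : ∀ {x} → ¬ Adj x x
open Graph public

data Walk {n : ℕ} (R : Fin n → Fin n → Set) : Fin n → Fin n → List (Fin n) → Set where
  here : ∀ {x} → Walk R x x (x ∷ [])
  step : ∀ {x y z ps} → R x y → Walk R y z ps → Walk R x z (x ∷ ps)

Path : {n : ℕ} → (Fin n → Fin n → Set) → Fin n → Fin n → List (Fin n) → Set
Path R x y ps = Walk R x y ps × Unique ps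

HasCycle : {n : ℕ} → (Fin n → Fin n → Set) → Set
HasCycle {n} R = Σ (Fin n) λ x → Σ (Fin n) λ y → Σ (List (Fin n)) λ ps →
  Path R x y ps × length ps ≥ 3 × R y x

Forest : {n : ℕ} → (Fin n → Fin n → Set) → Set
Forest R = ¬ HasCycle R

record EdgeSet {n : ℕ} (G : Graph n) : Set₁ where
  field
    Mem    : Fin n → Fin n → Set
    memSym : ∀ {x y} → Mem x y → Mem y x
    sub    : ∀ {x y} → Mem x y → Adj G x y
open EdgeSet public

Minus : {n : ℕ} (G : Graph n) → EdgeSet G → Fin n → Fin n → Set
Minus G F x y = Adj G x y × ¬ Mem F x y

IsFeedbackEdgeSet : {n : ℕ} (G : Graph n) → EdgeSet G → Set
IsFeedbackEdgeSet G F = Forest (Minus G F)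

Endpoint : {n : ℕ} {G : Graph n} → EdgeSet G → Fin n → Set
Endpoint F x = ∃ λ y → Mem F x y

-- w lies on the (unique, since G - F is a forest) u–v path of G - F.
-- If u, v lie in different components there is no such path, so nothing is satisfied.
OnPath : {n : ℕ} (G : Graph n) (F : EdgeSet G) → Fin n → Fin n → Fin n → Set
OnPath {n} G F u v w = Σ (List (Fin n)) λ ps → Path (Minus G F) u v ps × w ∈ ps

Satisfied : {n : ℕ} (G : Graph n) (F : EdgeSet G) → Fin n → Fin n → Fin n → Set
Satisfied G F u v w = OnPath G F u v w × Adj G w u × Adj G w v

-- Two distinct such vertices w₁, w₂ are common neighbours of u and v, and no edge
-- of F touches them, so u w₁ v w₂ is a 4-cycle of the forest G − F.
{-# OPTIONS --safe #-}
module Submission where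

open import Defs
open import Data.Nat using (ℕ; s≤s; z≤n)
open import Data.Fin using (Fin; _≟_)
open import Data.List using ([]; _∷_)
open import Data.List.Relation.Unary.All using ([]; _∷_)
open import Data.List.Relation.Unary.AllPairs using ([]; _∷_)
open import Data.List.Relation.Unary.Unique.Propositional using (Unique)
open import Data.Product using (_,_; proj₁)
open import Function using (_∘_)
open import Relation.Nullary using (¬_)
open import Relation.Nullary.Decidable using (decidable-stable)
open import Relation.Binary.PropositionalEquality using (_≡_; _≢_; refl; ≢-sym)

module _ {n : ℕ} {R : Fin n → Fin n → Set} (R-irrefl : ∀ {x} → ¬ R x x) where

  R⇒≢ : ∀ {x y} → R x y → x ≢ y
  R⇒≢ r refl = R-irrefl r

  square⇒HasCycle : ∀ {a b c d} → R a b → R b c → R c d → R d a →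
                    a ≢ c → b ≢ d → HasCycle R
  square⇒HasCycle {a} {b} {c} {d} ab bc cd da a≢c b≢d =
    a , d , (a ∷ b ∷ c ∷ d ∷ []) , (walk , unique) , s≤s (s≤s (s≤s z≤n)) , da
    where
    walk : Walk R a d (a ∷ b ∷ c ∷ d ∷ [])
    walk = step ab (step bc (step cd here))
    unique : Unique (a ∷ b ∷ c ∷ d ∷ [])
    unique = (R⇒≢ ab ∷ a≢c ∷ ≢-sym (R⇒≢ da) ∷ [])
           ∷ (R⇒≢ bc ∷ b≢d ∷ []) ∷ (R⇒≢ cd ∷ []) ∷ [] ∷ []

module _ {n : ℕ} (G : Graph n) (F : EdgeSet G) where

  Minus-irrefl : ∀ {x} → ¬ Minus G F x x
  Minus-irrefl = irrefl G ∘ proj₁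

  Minus-sym : ∀ {x y} → Minus G F x y → Minus G F y x
  Minus-sym (xy , xy∉F) = Graph.sym G xy , xy∉F ∘ memSym F

  Adj⇒Minus-of-¬Endpoint : ∀ {x y} → ¬ Endpoint F x → Adj G x y → Minus G F x y
  Adj⇒Minus-of-¬Endpoint {y = y} x∉D xy = xy , λ xy∈F → x∉D (y , xy∈F)

mainTheorem10 : {n : ℕ} (G : Graph n) (F : EdgeSet G) → IsFeedbackEdgeSet G F →
    (u v : Fin n) → Mem F u v →
    (w₁ w₂ : Fin n) →
    ¬ Endpoint F w₁ → Satisfied G F u v w₁ →
    ¬ Endpoint F w₂ → Satisfied G F u v w₂ →
    w₁ ≡ w₂
mainTheorem10 G F forest u v uv w₁ w₂ w₁∉D (_ , w₁u , w₁v) w₂∉D (_ , w₂u , w₂v) =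
  decidable-stable (w₁ ≟ w₂) λ w₁≢w₂ →
    forest (square⇒HasCycle (Minus-irrefl G F)
      (Minus-sym G F (edge w₁∉D w₁u)) (edge w₁∉D w₁v)
      (Minus-sym G F (edge w₂∉D w₂v)) (edge w₂∉D w₂u)
      (R⇒≢ {R = Adj G} (irrefl G) (sub F uv)) w₁≢w₂)
  where
  edge : ∀ {x y} → ¬ Endpoint F x → Adj G x y → Minus G F x y
  edge = Adj⇒Minus-of-¬Endpoint G F
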